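{- Let $t\ge 1$. Every permutation that is sorted by the right-greedy algorithm on $t$ stacks in series is also sorted by the left-greedy algorithm on $t$ stacks in series.
   Context: Sorting with $t$ stacks in series: the positions, ordered from right to left, are the input, stack $1$, stack $2$, ..., stack $t$, and the output. A permutation $p=p_1\cdots p_n$ of $\{1,\dots,n\}$ starts in the input, whose elements are taken in the order $p_1,p_2,\dots$. Legal moves: move the next input element onto the top of stack $1$; for $1\le k<t$ move the top of stack $k$ onto the top of stack $k+1$; move the top of stack $t$ to the output, allowed only if it is the smallest element not yet output. Moves into stacks are legal only if every stack remains increasing from top to bottom (smallest on top). A move is further left than another if its destination is further left (output leftmost, stack $k+1$ left of stack $k$, stack $1$ left of the input). The left-greedy algorithm always performs the leftmost legal move; the right-greedy algorithm always performs the rightmost legal move. An algorithm fails if not all elements have been output and no legal move exists; it sorts $p$ if it outputs all elements (necessarily in the order $1,2,\dots,n$) without failing. -}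

module Defs where

open import Data.Nat using (ℕ; zero; suc; _≤ᵇ_; _<ᵇ_; _+_; _≡ᵇ_)
open import Data.Bool using (Bool; true; false; _∧_; if_then_else_)
open import Data.List using (List; []; _∷_; _++_; concat; replicate; reverse; upTo; map)
open import Data.Maybe using (Maybe; just; nothing; _>>=_)
open import Data.Product using (∃-syntax)
open import Relation.Binary.PropositionalEquality using (_≡_)

-- A configuration is a list of t+1 lists:
--   position 0 = the input (head = next element to be read),
--   position i (1 ≤ i ≤ t) = stack i (head = top of the stack).
-- Elements already output are simply gone.
Config : Set
Config = List (List ℕ)

nth : ℕ → Config → List ℕ
nth _       []       = []
nth zero    (x ∷ xs) = x
nth (suc i) (x ∷ xs) = nth i xs

setAt : ℕ → List ℕ → Config → Config
setAt _       v []       = []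
setAt zero    v (x ∷ xs) = v ∷ xs
setAt (suc i) v (x ∷ xs) = x ∷ setAt i v xs

allB : (ℕ → Bool) → List ℕ → Bool
allB f []       = true
allB f (x ∷ xs) = f x ∧ allB f xs

increasing : List ℕ → Bool
increasing []           = true
increasing (x ∷ [])     = true
increasing (x ∷ y ∷ ys) = (x <ᵇ y) ∧ increasing (y ∷ ys)

-- The move whose destination is position d (d = 1 … t : stack d, taking
-- the top of position d-1, i.e. the next input element if d = 1;
-- d = t+1 : the output, taking the top of stack t).
move : (t : ℕ) → ℕ → Config → Maybe Config
move t zero c = nothing
move t (suc k) c with nth k c
... | []     = nothing
... | x ∷ xs with k ≡ᵇ t
...   | true =
          let c' = setAt k xs c in
          if allB (λ y → x ≤ᵇ y) (concat c') then just c' else nothing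
...   | false =
          let c' = setAt (suc k) (x ∷ nth (suc k) c) (setAt k xs c) in
          if increasing (nth (suc k) c') then just c' else nothing

firstLegal : (t : ℕ) → List ℕ → Config → Maybe Config
firstLegal t []       c = nothing
firstLegal t (d ∷ ds) c with move t d c
... | just c' = just c'
... | nothing = firstLegal t ds c

-- destinations from right to left: 1 (stack 1), 2, …, t, t+1 (output)
rightToLeft : ℕ → List ℕ
rightToLeft t = map suc (upTo (suc t))

revL : List ℕ → List ℕ
revL = reverse

leftGreedyStep : (t : ℕ) → Config → Maybe Config
leftGreedyStep t = firstLegal t (revL (rightToLeft t))

rightGreedyStep : (t : ℕ) → Config → Maybe Config
rightGreedyStep t = firstLegal t (rightToLeft t)

run : (Config → Maybe Config) → ℕ → Config → Maybe Config
run step zero    c = just c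
run step (suc k) c = step c >>= run step k

initial : (t : ℕ) → List ℕ → Config
initial t p = p ∷ replicate t []

finished : (t : ℕ) → Config
finished t = replicate (suc t) []

Sorts : (t : ℕ) → (Config → Maybe Config) → List ℕ → Set
Sorts t step p = ∃[ k ] (run step k (initial t p) ≡ just (finished t))

{-# OPTIONS --safe #-}
module Submission where

-- Run the right-greedy algorithm from X and the left-greedy algorithm from Y side by side,
-- keeping Y ahead of X: both have the same input, and every element on stack j of Y lies on
-- some stack j' ≤ j of X, so whatever X has output, Y has output too.  Whenever Y can move an
-- element off a stack, the left-greedy algorithm does so; this keeps Y ahead and lowers a
-- weight.  Otherwise Y can only push, and X makes its right-greedy move.  If X pushes, Y can
-- push too.  If X moves its top x off stack s, the moves between stacks 1, …, s were illegal
-- in X, which forces every element of those stacks to be at least x; so were x on stack s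
-- of Y, Y could move its top off stack s.  Hence Y stays ahead, and is finished when X is.

open import Defs
open import Data.Bool using (true; false)
open import Data.Bool.Properties using (T-≡; ∧-conicalˡ; ∧-conicalʳ; ¬-not)
open import Data.Empty using (⊥-elim)
open import Data.List using (List; []; _∷_; length; concat; replicate; reverse; map; upTo; applyUpTo; applyDownFrom)
open import Data.List.Membership.Propositional using (_∈_; _∉_)
open import Data.List.Membership.Propositional.Properties using (∈-++⁺ˡ; ∈-++⁺ʳ; ∈-++⁻)
open import Data.List.Properties using (length-replicate; map-upTo; reverse-applyUpTo)
open import Data.List.Relation.Binary.Permutation.Propositional using (_↭_; ↭-sym; ↭⇒↭ₛ)
import Data.List.Relation.Unary.All as All
open import Data.List.Relation.Unary.AllPairs using (_∷_)
open import Data.List.Relation.Unary.Any using (here; there)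
open import Data.List.Relation.Unary.Unique.Propositional using (Unique)
open import Data.List.Relation.Unary.Unique.Propositional.Properties using (map⁺; upTo⁺)
open import Data.Maybe using (just; nothing; _>>=_)
open import Data.Maybe.Properties using (just-injective)
open import Data.Nat
open import Data.Nat.Induction using (<-wellFounded)
open import Data.Nat.Properties
open import Data.Nat.Tactic.RingSolver using (solve-∀)
open import Data.Product using (∃-syntax; _×_; _,_; proj₂)
open import Data.Sum using (_⊎_; inj₁; inj₂)
open import Function using (_∘_; case_of_)
open import Function.Bundles using (Equivalence)
open import Induction.WellFounded using (Acc; acc)
open import Relation.Binary.PropositionalEquality
open import Relation.Nullary using (¬_; yes; no; contradiction)

open import Data.List.Relation.Binary.Permutation.Setoid.Properties (setoid ℕ) using (Unique-resp-↭)

nth-setAt-≡ : ∀ j (v : List ℕ) c → j < length c → nth j (setAt j v c) ≡ v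
nth-setAt-≡ zero    v (_ ∷ c) _         = refl
nth-setAt-≡ (suc j) v (_ ∷ c) (s≤s j<) = nth-setAt-≡ j v c j<

nth-setAt-≢ : ∀ {i j} (v : List ℕ) c → i ≢ j → nth i (setAt j v c) ≡ nth i c
nth-setAt-≢ {i}     {j}     v []      _   = refl
nth-setAt-≢ {zero}  {zero}  v (_ ∷ c) i≢j = contradiction refl i≢j
nth-setAt-≢ {zero}  {suc j} v (_ ∷ c) _   = refl
nth-setAt-≢ {suc i} {zero}  v (_ ∷ c) _   = refl
nth-setAt-≢ {suc i} {suc j} v (_ ∷ c) i≢j = nth-setAt-≢ v c (i≢j ∘ cong suc)

length-setAt : ∀ j (v : List ℕ) c → length (setAt j v c) ≡ length c
length-setAt j       v []      = refl
length-setAt zero    v (_ ∷ c) = refl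
length-setAt (suc j) v (_ ∷ c) = cong suc (length-setAt j v c)

nth-replicate : ∀ i n → nth i (replicate n []) ≡ []
nth-replicate i       zero    = refl
nth-replicate zero    (suc n) = refl
nth-replicate (suc i) (suc n) = nth-replicate i n

∈-nth⇒<length : ∀ {v : ℕ} i c → v ∈ nth i c → i < length c
∈-nth⇒<length zero    (_ ∷ c) _   = s≤s z≤n
∈-nth⇒<length (suc i) (_ ∷ c) v∈ = s≤s (∈-nth⇒<length i c v∈)

∈-nth-setAt⁻ : ∀ {v : ℕ} i j w c → v ∈ nth i (setAt j w c) →
               (i ≡ j × v ∈ w) ⊎ (i ≢ j × v ∈ nth i c)
∈-nth-setAt⁻ i j w c v∈ with i ≟ j
... | no i≢j = inj₂ (i≢j , subst (_ ∈_) (nth-setAt-≢ w c i≢j) v∈)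
... | yes refl = inj₁ (refl , subst (_ ∈_) (nth-setAt-≡ i w c i<) v∈)
  where i< = subst (i <_) (length-setAt i w c) (∈-nth⇒<length i (setAt i w c) v∈)

∈-concat⇒∈-nth : ∀ {v : ℕ} c → v ∈ concat c → ∃[ i ] v ∈ nth i c
∈-concat⇒∈-nth (s ∷ c) v∈ with ∈-++⁻ s v∈
... | inj₁ v∈s = zero , v∈s
... | inj₂ v∈c with ∈-concat⇒∈-nth c v∈c
...   | i , v∈cᵢ = suc i , v∈cᵢ

∈-nth⇒∈-concat : ∀ {v : ℕ} i c → v ∈ nth i c → v ∈ concat c
∈-nth⇒∈-concat zero    (s ∷ c) v∈ = ∈-++⁺ˡ v∈
∈-nth⇒∈-concat (suc i) (s ∷ c) v∈ = ∈-++⁺ʳ s (∈-nth⇒∈-concat i c v∈)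

allB-sound : ∀ f (l : List ℕ) → allB f l ≡ true → ∀ {z} → z ∈ l → f z ≡ true
allB-sound f (x ∷ l) ok (here refl) = ∧-conicalˡ (f x) _ ok
allB-sound f (x ∷ l) ok (there z∈) = allB-sound f l (∧-conicalʳ (f x) _ ok) z∈

allB-complete : ∀ f (l : List ℕ) → (∀ {z} → z ∈ l → f z ≡ true) → allB f l ≡ true
allB-complete f []      _  = refl
allB-complete f (x ∷ l) ok rewrite ok (here refl) = allB-complete f l (ok ∘ there)

<ᵇ≡true⇒< : ∀ {m n} → (m <ᵇ n) ≡ true → m < n
<ᵇ≡true⇒< {m} {n} eq = <ᵇ⇒< m n (Equivalence.from T-≡ eq)

<⇒<ᵇ≡true : ∀ {m n} → m < n → (m <ᵇ n) ≡ true
<⇒<ᵇ≡true = Equivalence.to T-≡ ∘ <⇒<ᵇ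

≤ᵇ≡true⇒≤ : ∀ {m n} → (m ≤ᵇ n) ≡ true → m ≤ n
≤ᵇ≡true⇒≤ {m} {n} eq = ≤ᵇ⇒≤ m n (Equivalence.from T-≡ eq)

≤⇒≤ᵇ≡true : ∀ {m n} → m ≤ n → (m ≤ᵇ n) ≡ true
≤⇒≤ᵇ≡true = Equivalence.to T-≡ ∘ ≤⇒≤ᵇ

≡ᵇ≡true⇒≡ : ∀ {m n} → (m ≡ᵇ n) ≡ true → m ≡ n
≡ᵇ≡true⇒≡ {m} {n} eq = ≡ᵇ⇒≡ m n (Equivalence.from T-≡ eq)

≡⇒≡ᵇ≡true : ∀ {m n} → m ≡ n → (m ≡ᵇ n) ≡ true
≡⇒≡ᵇ≡true {m} {n} = Equivalence.to T-≡ ∘ ≡⇒≡ᵇ m n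

≢⇒≡ᵇ≡false : ∀ {m n} → m ≢ n → (m ≡ᵇ n) ≡ false
≢⇒≡ᵇ≡false {m} {n} m≢n = ¬-not (m≢n ∘ ≡ᵇ≡true⇒≡)

Increasing : List ℕ → Set
Increasing l = increasing l ≡ true

Increasing-tail : ∀ x xs → Increasing (x ∷ xs) → Increasing xs
Increasing-tail x []       _   = refl
Increasing-tail x (y ∷ ys) inc = ∧-conicalʳ (x <ᵇ y) _ inc

Increasing-head< : ∀ x xs → Increasing (x ∷ xs) → ∀ {w} → w ∈ xs → x < w
Increasing-head< x (y ∷ ys) inc (here refl) = <ᵇ≡true⇒< (∧-conicalˡ (x <ᵇ y) _ inc)
Increasing-head< x (y ∷ ys) inc (there w∈) =
  <-trans (<ᵇ≡true⇒< (∧-conicalˡ (x <ᵇ y) _ inc)) (Increasing-head< y ys (Increasing-tail x (y ∷ ys) inc) w∈)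

Increasing-head≤ : ∀ x xs → Increasing (x ∷ xs) → ∀ {w} → w ∈ x ∷ xs → x ≤ w
Increasing-head≤ x xs inc (here refl) = ≤-refl
Increasing-head≤ x xs inc (there w∈) = <⇒≤ (Increasing-head< x xs inc w∈)

Increasing-∷ : ∀ x l → Increasing l → (∀ {w} → w ∈ l → x < w) → Increasing (x ∷ l)
Increasing-∷ x []      _   _    = refl
Increasing-∷ x (y ∷ l) inc x<l rewrite <⇒<ᵇ≡true (x<l (here refl)) = inc

Ordered : ℕ → List ℕ → Set
Ordered zero    = Unique
Ordered (suc _) = Increasing

Ordered-tail : ∀ i {x xs} → Ordered i (x ∷ xs) → Ordered i xs
Ordered-tail zero            (_ ∷ unique) = unique
Ordered-tail (suc i) {x} {xs} inc         = Increasing-tail x xs inc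

Ordered-head∉ : ∀ i {x xs} → Ordered i (x ∷ xs) → x ∉ xs
Ordered-head∉ zero    (x≢xs ∷ _) x∈ = All.lookup x≢xs x∈ refl
Ordered-head∉ (suc i) inc         x∈ = <-irrefl refl (Increasing-head< _ _ inc x∈)

record WellFormed (t : ℕ) (c : Config) : Set where
  field
    length≡  : length c ≡ suc t
    ordered  : ∀ i → Ordered i (nth i c)
    disjoint : ∀ {i j v} → v ∈ nth i c → v ∈ nth j c → i ≡ j
open WellFormed

module _ {t c} (wf : WellFormed t c) where

  top∉rest : ∀ {k x xs} → nth k c ≡ x ∷ xs → x ∉ xs
  top∉rest {k} e = Ordered-head∉ k (subst (Ordered k) e (ordered wf k))

  ∈-nth⇒≤t : ∀ {i v} → v ∈ nth i c → i ≤ t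
  ∈-nth⇒≤t {i} v∈ = ≤-pred (subst (i <_) (length≡ wf) (∈-nth⇒<length i c v∈))

  stack-top≤ : ∀ {j h hs w} → nth (suc j) c ≡ h ∷ hs → w ∈ h ∷ hs → h ≤ w
  stack-top≤ {j} e = Increasing-head≤ _ _ (subst Increasing e (ordered wf (suc j)))

shiftTop : ℕ → ℕ → List ℕ → Config → Config
shiftTop k x xs c = setAt (suc k) (x ∷ nth (suc k) c) (setAt k xs c)

nth-shiftTop : ∀ k x xs c → suc k < length c → nth (suc k) (shiftTop k x xs c) ≡ x ∷ nth (suc k) c
nth-shiftTop k x xs c k< = nth-setAt-≡ (suc k) _ (setAt k xs c) (subst (suc k <_) (sym (length-setAt k xs c)) k<)

nth-shiftTop-source : ∀ k x xs c → nth k c ≡ x ∷ xs → nth k (shiftTop k x xs c) ≡ xs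
nth-shiftTop-source k x xs c e =
  trans (nth-setAt-≢ _ (setAt k xs c) (1+n≢n ∘ sym))
        (nth-setAt-≡ k xs c (∈-nth⇒<length k c (subst (x ∈_) (sym e) (here refl))))

∈-pop⁺ : ∀ {k x xs} c {i v} → nth k c ≡ x ∷ xs → v ∈ nth i c → v ≢ x → v ∈ nth i (setAt k xs c)
∈-pop⁺ {k} {x} {xs} c {i} e v∈ v≢x with i ≟ k
... | no i≢k = subst (_ ∈_) (sym (nth-setAt-≢ xs c i≢k)) v∈
... | yes refl with subst (_ ∈_) e v∈
...   | here v≡x = contradiction v≡x v≢x
...   | there v∈xs = subst (_ ∈_) (sym (nth-setAt-≡ k xs c (∈-nth⇒<length k c v∈))) v∈xs

∈-shiftTop⁺ : ∀ {k x xs} c {i v} → nth k c ≡ x ∷ xs → v ∈ nth i c → v ≢ x → v ∈ nth i (shiftTop k x xs c)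
∈-shiftTop⁺ {k} {x} {xs} c {i} e v∈ v≢x with i ≟ suc k
... | no i≢k+1 = subst (_ ∈_) (sym (nth-setAt-≢ _ (setAt k xs c) i≢k+1)) (∈-pop⁺ c e v∈ v≢x)
... | yes refl = subst (_ ∈_) (sym (nth-shiftTop k x xs c (∈-nth⇒<length (suc k) c v∈))) (there v∈)

module _ {t c} (wf : WellFormed t c) {k x xs} (e : nth k c ≡ x ∷ xs) where

  private
    x∈k : x ∈ nth k c
    x∈k = subst (x ∈_) (sym e) (here refl)

  ∈-pop⁻ : ∀ {i v} → v ∈ nth i (setAt k xs c) → v ≢ x × v ∈ nth i c
  ∈-pop⁻ {i} v∈ with ∈-nth-setAt⁻ i k xs c v∈
  ... | inj₁ (refl , v∈xs) = (λ { refl → top∉rest wf e v∈xs }) , subst (_ ∈_) (sym e) (there v∈xs)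
  ... | inj₂ (i≢k , v∈c)   = (λ { refl → i≢k (disjoint wf v∈c x∈k) }) , v∈c

  ∈-shiftTop⁻ : ∀ {i v} → v ∈ nth i (shiftTop k x xs c) → (i ≡ suc k × v ≡ x) ⊎ (v ≢ x × v ∈ nth i c)
  ∈-shiftTop⁻ {i} v∈ with ∈-nth-setAt⁻ i (suc k) (x ∷ nth (suc k) c) (setAt k xs c) v∈
  ... | inj₁ (refl , here refl)  = inj₁ (refl , refl)
  ... | inj₁ (refl , there v∈c) = inj₂ ((λ { refl → 1+n≢n (disjoint wf v∈c x∈k) }) , v∈c)
  ... | inj₂ (_ , v∈c)          = inj₂ (∈-pop⁻ v∈c)

data Step (t k : ℕ) (c : Config) : Config → Set where
  to-output : ∀ {x xs} → k ≡ t → nth k c ≡ x ∷ xs →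
              (∀ {i z} → z ∈ nth i (setAt k xs c) → x ≤ z) → Step t k c (setAt k xs c)
  to-stack  : ∀ {x xs} → k ≢ t → nth k c ≡ x ∷ xs →
              (∀ {w} → w ∈ nth (suc k) c → x < w) → Step t k c (shiftTop k x xs c)

module _ {t c} (wf : WellFormed t c) where

  shiftTop-bound : ∀ {k x xs} → k ≢ t → nth k c ≡ x ∷ xs → suc k < length c
  shiftTop-bound {k} {x} k≢t e =
    subst (suc k <_) (sym (length≡ wf)) (s≤s (≤∧≢⇒< (∈-nth⇒≤t wf (subst (x ∈_) (sym e) (here refl))) k≢t))

  step-sound : ∀ {k c'} → Step t k c c' → move t (suc k) c ≡ just c'
  step-sound {k} (to-output {x} {xs} k≡t e x≤)
    rewrite e | ≡⇒≡ᵇ≡true k≡t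
          | allB-complete (λ y → x ≤ᵇ y) (concat (setAt k xs c))
              (λ z∈ → let (i , z∈ᵢ) = ∈-concat⇒∈-nth (setAt k xs c) z∈ in ≤⇒≤ᵇ≡true (x≤ z∈ᵢ))
    = refl
  step-sound {k} (to-stack {x} {xs} k≢t e x<)
    rewrite e | ≢⇒≡ᵇ≡false k≢t
          | nth-shiftTop k x xs c (shiftTop-bound k≢t e)
          | Increasing-∷ x (nth (suc k) c) (ordered wf (suc k)) x<
    = refl

  step-complete : ∀ {k c'} → move t (suc k) c ≡ just c' → Step t k c c'
  step-complete {k} eq with nth k c in e
  ... | x ∷ xs with k ≡ᵇ t in k≡ᵇt
  ...   | true with allB (λ y → x ≤ᵇ y) (concat (setAt k xs c)) in ok
  ...     | true = subst (Step t k c) (just-injective eq) (to-output (≡ᵇ≡true⇒≡ k≡ᵇt) e x≤)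
    where
      x≤ : ∀ {i z} → z ∈ nth i (setAt k xs c) → x ≤ z
      x≤ {i} z∈ = ≤ᵇ≡true⇒≤ (allB-sound _ _ ok (∈-nth⇒∈-concat i (setAt k xs c) z∈))
  step-complete {k} eq | x ∷ xs | false with increasing (nth (suc k) (shiftTop k x xs c)) in inc
  ...     | true = subst (Step t k c) (just-injective eq) (to-stack k≢t e x<)
    where
      k≢t : k ≢ t
      k≢t k≡t with () ← trans (sym (≡⇒≡ᵇ≡true k≡t)) k≡ᵇt
      x< : ∀ {w} → w ∈ nth (suc k) c → x < w
      x< = Increasing-head< x _ (trans (cong increasing (sym (nth-shiftTop k x xs c (shiftTop-bound k≢t e)))) inc)

module _ {t c} (wf : WellFormed t c) {k x xs} (e : nth k c ≡ x ∷ xs) where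

  private
    k<length : k < length c
    k<length = ∈-nth⇒<length k c (subst (x ∈_) (sym e) (here refl))

  pop-wf : WellFormed t (setAt k xs c)
  pop-wf = record
    { length≡  = trans (length-setAt k xs c) (length≡ wf)
    ; ordered  = ordered′
    ; disjoint = λ v∈ v∈′ → disjoint wf (proj₂ (∈-pop⁻ wf e v∈)) (proj₂ (∈-pop⁻ wf e v∈′))
    }
    where
      ordered′ : ∀ i → Ordered i (nth i (setAt k xs c))
      ordered′ i with i ≟ k
      ... | no i≢k   = subst (Ordered i) (sym (nth-setAt-≢ xs c i≢k)) (ordered wf i)
      ... | yes refl = subst (Ordered i) (sym (nth-setAt-≡ i xs c k<length))
                         (Ordered-tail i (subst (Ordered i) e (ordered wf i)))

  shiftTop-wf : k ≢ t → (∀ {w} → w ∈ nth (suc k) c → x < w) → WellFormed t (shiftTop k x xs c)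
  shiftTop-wf k≢t x< = record
    { length≡  = trans (length-setAt (suc k) _ (setAt k xs c)) (length≡ (pop-wf))
    ; ordered  = ordered′
    ; disjoint = disjoint′
    }
    where
      ordered′ : ∀ i → Ordered i (nth i (shiftTop k x xs c))
      ordered′ i with i ≟ suc k
      ... | no i≢k+1 = subst (Ordered i) (sym (nth-setAt-≢ _ (setAt k xs c) i≢k+1)) (ordered pop-wf i)
      ... | yes refl = subst Increasing (sym (nth-shiftTop k x xs c (shiftTop-bound wf k≢t e)))
                         (Increasing-∷ x (nth (suc k) c) (ordered wf (suc k)) x<)
      disjoint′ : ∀ {i j v} → v ∈ nth i (shiftTop k x xs c) → v ∈ nth j (shiftTop k x xs c) → i ≡ j
      disjoint′ v∈ v∈′ with ∈-shiftTop⁻ wf e v∈ | ∈-shiftTop⁻ wf e v∈′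
      ... | inj₁ (refl , _)   | inj₁ (refl , _)    = refl
      ... | inj₁ (_ , v≡x)   | inj₂ (v≢x , _)     = contradiction v≡x v≢x
      ... | inj₂ (v≢x , _)   | inj₁ (_ , v≡x)     = contradiction v≡x v≢x
      ... | inj₂ (_ , v∈c)   | inj₂ (_ , v∈c′)    = disjoint wf v∈c v∈c′

step-wf : ∀ {t k c c'} → WellFormed t c → Step t k c c' → WellFormed t c'
step-wf wf (to-output _ e _)   = pop-wf wf e
step-wf wf (to-stack k≢t e x<) = shiftTop-wf wf e k≢t x<

move-wf : ∀ {t d c c'} → WellFormed t c → move t d c ≡ just c' → WellFormed t c'
move-wf {d = suc k} wf mv = step-wf wf (step-complete wf mv)

step-input : ∀ {t k c c'} → Step t (suc k) c c' → nth 0 c' ≡ nth 0 c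
step-input {c = c} (to-output {xs = xs} _ _ _) = nth-setAt-≢ xs c (λ ())
step-input {k = k} {c} (to-stack {xs = xs} _ _ _) =
  trans (nth-setAt-≢ _ (setAt (suc k) xs c) (λ ())) (nth-setAt-≢ xs c (λ ()))

-- An element at position i of a configuration with L positions contributes L - i, so a move
-- onto a stack lowers the weight by exactly one and a move to the output by at least one.
weight : Config → ℕ
weight []      = 0
weight (s ∷ c) = length s * suc (length c) + weight c

weight-pop : ∀ k {x xs} c → nth k c ≡ x ∷ xs → weight (setAt k xs c) < weight c
weight-pop zero {xs = xs} (_ ∷ c) refl =
  +-monoˡ-< (weight c) (*-monoˡ-< (suc (length c)) (n<1+n (length xs)))
weight-pop (suc k) {xs = xs} (s ∷ c) e rewrite length-setAt k xs c =
  +-monoʳ-< (length s * suc (length c)) (weight-pop k c e)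

weight-shiftTop : ∀ k {x xs} c → nth k c ≡ x ∷ xs → suc k < length c →
                  suc (weight (shiftTop k x xs c)) ≡ weight c
weight-shiftTop zero {xs = xs} (_ ∷ b ∷ c) refl _ =
  solve (length xs) (length b) (length c) (weight c)
  where
    solve : ∀ a m L w → suc (a * suc (suc L) + (suc m * suc L + w)) ≡ suc a * suc (suc L) + (m * suc L + w)
    solve = solve-∀
weight-shiftTop zero (_ ∷ []) refl (s≤s ())
weight-shiftTop (suc k) {x} {xs} (s ∷ c) e (s≤s k<)
  rewrite length-setAt (suc k) (x ∷ nth (suc k) c) (setAt k xs c) | length-setAt k xs c =
  trans (sym (+-suc _ _)) (cong (length s * suc (length c) +_) (weight-shiftTop k c e k<))

step-weight< : ∀ {t k c c'} → WellFormed t c → Step t k c c' → weight c' < weight c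
step-weight< {k = k} {c} wf (to-output _ e _) = weight-pop k c e
step-weight< {k = k} {c} wf (to-stack k≢t e _) =
  ≤-reflexive (weight-shiftTop k c e (shiftTop-bound wf k≢t e))

Blocked : ℕ → Config → ℕ → ℕ → Set
Blocked t c a b = ∀ {d} → a ≤ d → d < b → move t d c ≡ nothing

PushOnly : ℕ → Config → Set
PushOnly t Y = Blocked t Y 2 (2 + t)

module _ {t c} (wf : WellFormed t c) where

  blocked⇒¬top<next : ∀ {k x xs} → k ≢ t → nth k c ≡ x ∷ xs → move t (suc k) c ≡ nothing →
                       ¬ (∀ {w} → w ∈ nth (suc k) c → x < w)
  blocked⇒¬top<next k≢t e blocked x< with () ← trans (sym (step-sound wf (to-stack k≢t e x<))) blocked

  blocked⇒next-has-≤top : ∀ {i h hs} → suc i ≢ t → move t (2 + i) c ≡ nothing →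
                                nth (suc i) c ≡ h ∷ hs → ∃[ w ] w ∈ nth (2 + i) c × w ≤ h
  blocked⇒next-has-≤top {i} {h} i+1≢t blocked e with nth (2 + i) c in e′
  ... | [] = ⊥-elim (blocked⇒¬top<next i+1≢t e blocked λ w∈ → case subst (_ ∈_) e′ w∈ of λ ())
  ... | h′ ∷ hs′ with h <? h′
  ...   | no h≮h′  = h′ , here refl , ≮⇒≥ h≮h′
  ...   | yes h<h′ = ⊥-elim (blocked⇒¬top<next i+1≢t e blocked λ w∈ →
                       <-≤-trans h<h′ (stack-top≤ wf e′ (subst (_ ∈_) e′ w∈)))

  blocked⇒earlier-stacks-≥top : ∀ {s x xs} → suc s ≤ t → nth (suc s) c ≡ x ∷ xs → Blocked t c 2 (2 + s) →
                                ∀ {j w} → j ≤ s → w ∈ nth (suc j) c → x ≤ w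
  blocked⇒earlier-stacks-≥top {s} {x} {xs} s+1≤t e blocked {j} j≤s = go (s ∸ j) (m+[n∸m]≡n j≤s)
    where
      go : ∀ g {j w} → j + g ≡ s → w ∈ nth (suc j) c → x ≤ w
      go zero    {j} j+0≡s w∈ with refl ← trans (sym (+-identityʳ j)) j+0≡s = stack-top≤ wf e (subst (_ ∈_) e w∈)
      go (suc g) {j} j+g+1≡s w∈ with nth (suc j) c in eⱼ
      ... | h ∷ hs =
        let j<s             = subst (j <_) j+g+1≡s (m<m+n j z<s)
            w' , w'∈ , w'≤h = blocked⇒next-has-≤top (<⇒≢ (≤-trans (s≤s j<s) s+1≤t))
                                (blocked (s≤s (s≤s z≤n)) (s≤s (s≤s j<s))) eⱼ
        in ≤-trans (go g (trans (sym (+-suc j g)) j+g+1≡s) w'∈) (≤-trans w'≤h (stack-top≤ wf eⱼ w∈))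

firstLegal-ascending : ∀ {t c c'} f a m → (∀ i → f i ≡ a + i) → firstLegal t (applyUpTo f m) c ≡ just c' →
                       ∃[ d ] move t d c ≡ just c' × Blocked t c a d
firstLegal-ascending {t} {c} {c'} f a (suc m) f≗ eq with move t (f 0) c in e
... | just _ = a , subst (λ d → move t d c ≡ just c') f0≡a (trans e eq) , λ a≤d d<a → contradiction a≤d (<⇒≱ d<a)
  where
    f0≡a : f 0 ≡ a
    f0≡a = trans (f≗ 0) (+-identityʳ a)
... | nothing with firstLegal-ascending (f ∘ suc) (suc a) m (λ i → trans (f≗ (suc i)) (+-suc a i)) eq
...   | d , mv , blocked = d , mv , blocked′
  where
    blocked′ : Blocked t c a d
    blocked′ {d'} a≤d' d'<d with a ≟ d'
    ... | yes refl = subst (λ d → move t d c ≡ nothing) (trans (f≗ 0) (+-identityʳ a)) e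
    ... | no a≢d'  = blocked (≤∧≢⇒< a≤d' a≢d') d'<d

firstLegal-descending : ∀ {t c c'} m → firstLegal t (applyDownFrom suc m) c ≡ just c' →
                        ∃[ d ] move t d c ≡ just c' × Blocked t c (suc d) (suc m)
firstLegal-descending {t} {c} (suc m) eq with move t (suc m) c in e
... | just _  = suc m , trans e eq , λ m+1<d d≤m+1 → contradiction m+1<d (≤⇒≯ (≤-pred d≤m+1))
... | nothing with firstLegal-descending m eq
...   | d , mv , blocked = d , mv , blocked′
  where
    blocked′ : Blocked t c (suc d) (suc (suc m))
    blocked′ {d'} d<d' d'≤m+1 with d' ≟ suc m
    ... | yes refl  = e
    ... | no d'≢m+1 = blocked d<d' (≤∧≢⇒< (≤-pred d'≤m+1) d'≢m+1)

firstLegal-descending-nothing : ∀ {t c} m → firstLegal t (applyDownFrom suc m) c ≡ nothing → Blocked t c 1 (suc m)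
firstLegal-descending-nothing zero eq 1≤d (s≤s d≤0) = contradiction (≤-trans 1≤d d≤0) λ ()
firstLegal-descending-nothing {t} {c} (suc m) eq {d} 1≤d d≤m+1 with move t (suc m) c in e
... | nothing with d ≟ suc m
...   | yes refl  = e
...   | no d≢m+1 = firstLegal-descending-nothing m eq 1≤d (≤∧≢⇒< (≤-pred d≤m+1) d≢m+1)

rightGreedyStep-just : ∀ {t c c'} → rightGreedyStep t c ≡ just c' → ∃[ d ] move t d c ≡ just c' × Blocked t c 1 d
rightGreedyStep-just {t} {c} {c'} eq =
  firstLegal-ascending suc 1 (suc t) (λ _ → refl) (subst (λ ds → firstLegal t ds c ≡ just c') (map-upTo suc (suc t)) eq)

leftGreedyStep≡firstLegal-descending : ∀ t c → leftGreedyStep t c ≡ firstLegal t (applyDownFrom suc (suc t)) c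
leftGreedyStep≡firstLegal-descending t c =
  cong (λ ds → firstLegal t ds c) (trans (cong reverse (map-upTo suc (suc t))) (reverse-applyUpTo suc (suc t)))

data LeftView (t : ℕ) (Y : Config) : Set where
  advance   : ∀ {k Y'} → leftGreedyStep t Y ≡ just Y' → Step t (suc k) Y Y' → LeftView t Y
  push-only : PushOnly t Y → (∀ {Y'} → move t 1 Y ≡ just Y' → leftGreedyStep t Y ≡ just Y') → LeftView t Y

leftView : ∀ {t Y} → WellFormed t Y → LeftView t Y
leftView {t} {Y} wf with leftGreedyStep t Y in eL
... | nothing = push-only (blocked ∘ ≤-trans (s≤s z≤n)) (λ push → case trans (sym (blocked ≤-refl (s≤s (s≤s z≤n)))) push of λ ())
  where
    blocked : Blocked t Y 1 (2 + t)
    blocked = firstLegal-descending-nothing (suc t) (trans (sym (leftGreedyStep≡firstLegal-descending t Y)) eL)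
... | just Y' with firstLegal-descending (suc t) (trans (sym (leftGreedyStep≡firstLegal-descending t Y)) eL)
...   | suc zero    , push , pushOnly = push-only pushOnly (λ push′ → trans eL (trans (sym push) push′))
...   | suc (suc k) , mv   , _        = advance eL (step-complete wf mv)

record Ahead (Y X : Config) : Set where
  field
    same-input : nth 0 Y ≡ nth 0 X
    behind     : ∀ {j v} → v ∈ nth (suc j) Y → ∃[ j' ] j' ≤ j × v ∈ nth (suc j') X
open Ahead

ahead-refl : ∀ X → Ahead X X
ahead-refl X = record { same-input = refl ; behind = λ {j} v∈ → j , ≤-refl , v∈ }

ahead-∈ : ∀ {Y X i v} → Ahead Y X → v ∈ nth i Y → ∃[ i' ] v ∈ nth i' X
ahead-∈ {i = zero}  Y≽X v∈ = 0 , subst (_ ∈_) (same-input Y≽X) v∈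
ahead-∈ {i = suc j} Y≽X v∈ with behind Y≽X v∈
... | j' , _ , v∈X = suc j' , v∈X

ahead-finished : ∀ {t Y} → WellFormed t Y → Ahead Y (finished t) → Y ≡ finished t
ahead-finished {t} {Y} wf Y≽fin = empty⇒replicate Y (length≡ wf) empty
  where
    empty : ∀ i → nth i Y ≡ []
    empty i with nth i Y in e
    ... | []    = refl
    ... | v ∷ _ with ahead-∈ Y≽fin (subst (v ∈_) (sym e) (here refl))
    ...   | i' , v∈ with () ← subst (v ∈_) (nth-replicate i' (suc t)) v∈
    empty⇒replicate : ∀ c {n} → length c ≡ n → (∀ i → nth i c ≡ []) → c ≡ replicate n []
    empty⇒replicate []      refl _     = refl
    empty⇒replicate (s ∷ c) refl empty = cong₂ _∷_ (empty 0) (empty⇒replicate c refl (empty ∘ suc))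

advance-keeps-ahead : ∀ {t k Y Y' X} → WellFormed t Y → Step t (suc k) Y Y' → Ahead Y X → Ahead Y' X
advance-keeps-ahead {t} {k} {Y} {X = X} wf step Y≽X = record
  { same-input = trans (step-input step) (same-input Y≽X) ; behind = behind′ step }
  where
    behind′ : ∀ {Y'} → Step t (suc k) Y Y' → ∀ {j v} → v ∈ nth (suc j) Y' → ∃[ j' ] j' ≤ j × v ∈ nth (suc j') X
    behind′ (to-output _ e _) v∈ = behind Y≽X (proj₂ (∈-pop⁻ wf e v∈))
    behind′ (to-stack _ e _) v∈ with ∈-shiftTop⁻ wf e v∈
    ... | inj₂ (_ , v∈Y) = behind Y≽X v∈Y
    ... | inj₁ (refl , refl) with behind Y≽X (subst (_ ∈_) (sym e) (here refl))
    ...   | j' , j'≤ , v∈X = j' , m≤n⇒m≤1+n j'≤ , v∈X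

push-keeps-ahead : ∀ {t X Y X'} → 1 ≤ t → WellFormed t X → WellFormed t Y → Ahead Y X →
                   Step t 0 X X' → ∃[ Y' ] Step t 0 Y Y' × Ahead Y' X'
push-keeps-ahead 1≤t _ _ _ (to-output 0≡t _ _) = contradiction 0≡t (<⇒≢ 1≤t)
push-keeps-ahead {t} {X} {Y} _ wfX wfY Y≽X (to-stack {u} {us} 0≢t e u<) =
  shiftTop 0 u us Y , to-stack 0≢t eY u<Y ,
  record { same-input = trans (nth-shiftTop-source 0 u us Y eY) (sym (nth-shiftTop-source 0 u us X e))
         ; behind     = behind′ }
  where
    eY : nth 0 Y ≡ u ∷ us
    eY = trans (same-input Y≽X) e
    u<Y : ∀ {w} → w ∈ nth 1 Y → u < w
    u<Y w∈ with behind Y≽X w∈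
    ... | zero , _ , w∈X = u< w∈X
    behind′ : ∀ {j v} → v ∈ nth (suc j) (shiftTop 0 u us Y) → ∃[ j' ] j' ≤ j × v ∈ nth (suc j') (shiftTop 0 u us X)
    behind′ v∈ with ∈-shiftTop⁻ wfY eY v∈
    ... | inj₁ (refl , refl) = 0 , z≤n , subst (u ∈_) (sym (nth-shiftTop 0 u us X (shiftTop-bound wfX 0≢t e))) (here refl)
    ... | inj₂ (v≢u , v∈Y) with behind Y≽X v∈Y
    ...   | j' , j'≤j , v∈X = j' , j'≤j , ∈-shiftTop⁺ X e v∈X v≢u

output-top-∉-pushOnly : ∀ {s X Y x xs} → WellFormed (suc s) X → WellFormed (suc s) Y → Ahead Y X →
                        PushOnly (suc s) Y → nth (suc s) X ≡ x ∷ xs →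
                        (∀ {i z} → z ∈ nth i (setAt (suc s) xs X) → x ≤ z) → x ∉ nth (suc s) Y
output-top-∉-pushOnly {s} {X} {Y} {x} wfX wfY Y≽X pushOnly e x≤ x∈Y with nth (suc s) Y in eY
... | h ∷ hs = case trans (sym (step-sound wfY (to-output refl eY h≤))) (pushOnly (s≤s (s≤s z≤n)) (n<1+n _)) of λ ()
  where
    x≤Y : ∀ {i z} → z ∈ nth i Y → x ≤ z
    x≤Y z∈ with ahead-∈ Y≽X z∈ | _ ≟ x
    ... | _ , z∈X | no z≢x = x≤ (∈-pop⁺ X e z∈X z≢x)
    ... | _       | yes refl = ≤-refl
    h≤ : ∀ {i z} → z ∈ nth i (setAt (suc s) hs Y) → h ≤ z
    h≤ z∈ = ≤-trans (stack-top≤ wfY eY x∈Y)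
                    (x≤Y (proj₂ (∈-pop⁻ wfY eY z∈)))

shifted-top-∉-pushOnly : ∀ {t s X Y x xs} → WellFormed t X → WellFormed t Y → Ahead Y X →
                         PushOnly t Y → Blocked t X 2 (2 + s) → suc s ≢ t → nth (suc s) X ≡ x ∷ xs →
                         (∀ {w} → w ∈ nth (2 + s) X → x < w) → x ∉ nth (suc s) Y
shifted-top-∉-pushOnly {t} {s} {X} {Y} {x} wfX wfY Y≽X pushOnly blockedX s+1≢t e x< x∈Y
  with nth (suc s) Y in eY
... | h ∷ hs = blocked⇒¬top<next wfY s+1≢t eY (pushOnly (s≤s (s≤s z≤n)) (s≤s (s≤s s+1≤t))) h<
  where
    s+1≤t : suc s ≤ t
    s+1≤t = ∈-nth⇒≤t wfX (subst (x ∈_) (sym e) (here refl))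
    x<Y : ∀ {w} → w ∈ nth (2 + s) Y → x < w
    x<Y w∈ with behind Y≽X w∈
    ... | j' , j'≤ , w∈X with j' ≟ suc s
    ...   | yes refl = x< w∈X
    ...   | no j'≢s+1 = ≤∧≢⇒< (blocked⇒earlier-stacks-≥top wfX s+1≤t e blockedX (≤-pred (≤∧≢⇒< j'≤ j'≢s+1)) w∈X)
                          λ { refl → 1+n≢n (sym (disjoint wfY (subst (x ∈_) (sym eY) x∈Y) w∈)) }
    h< : ∀ {w} → w ∈ nth (2 + s) Y → h < w
    h< w∈ = ≤-<-trans (stack-top≤ wfY eY x∈Y) (x<Y w∈)

moved-top-later : ∀ {t s j X Y x xs} → WellFormed t X → Ahead Y X → nth (suc s) X ≡ x ∷ xs →
                  x ∉ nth (suc s) Y → x ∈ nth (suc j) Y → s < j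
moved-top-later wfX Y≽X e x∉ x∈ with behind Y≽X x∈
... | j' , j'≤j , x∈X with disjoint wfX x∈X (subst (_ ∈_) (sym e) (here refl))
...   | refl = ≤∧≢⇒< j'≤j λ { refl → x∉ x∈ }

right-move-keeps-ahead : ∀ {t s X Y X'} → WellFormed t X → WellFormed t Y → Ahead Y X → PushOnly t Y →
                         Blocked t X 2 (2 + s) → Step t (suc s) X X' → Ahead Y X'
right-move-keeps-ahead {s = s} {X} {Y} wfX wfY Y≽X pushOnly _ step@(to-output {x} {xs} refl e x≤) =
  record { same-input = trans (same-input Y≽X) (sym (step-input step)) ; behind = behind′ }
  where
    behind′ : ∀ {j v} → v ∈ nth (suc j) Y → ∃[ j' ] j' ≤ j × v ∈ nth (suc j') (setAt (suc s) xs X)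
    behind′ {j} {v} v∈ with behind Y≽X v∈ | v ≟ x
    ... | j' , j'≤j , v∈X | no v≢x = j' , j'≤j , ∈-pop⁺ X e v∈X v≢x
    ... | _ | yes refl = contradiction (≤-pred (∈-nth⇒≤t wfY v∈))
                           (<⇒≱ (moved-top-later wfX Y≽X e (output-top-∉-pushOnly wfX wfY Y≽X pushOnly e x≤) v∈))
right-move-keeps-ahead {s = s} {X} {Y} wfX wfY Y≽X pushOnly blockedX step@(to-stack {x} {xs} s+1≢t e x<) =
  record { same-input = trans (same-input Y≽X) (sym (step-input step)) ; behind = behind′ }
  where
    behind′ : ∀ {j v} → v ∈ nth (suc j) Y → ∃[ j' ] j' ≤ j × v ∈ nth (suc j') (shiftTop (suc s) x xs X)
    behind′ {j} {v} v∈ with behind Y≽X v∈ | v ≟ x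
    ... | j' , j'≤j , v∈X | no v≢x = j' , j'≤j , ∈-shiftTop⁺ X e v∈X v≢x
    ... | _ | yes refl =
      suc s ,
      moved-top-later wfX Y≽X e (shifted-top-∉-pushOnly wfX wfY Y≽X pushOnly blockedX s+1≢t e x<) v∈ ,
      subst (x ∈_) (sym (nth-shiftTop (suc s) x xs X (shiftTop-bound wfX s+1≢t e))) (here refl)

module _ {t} (1≤t : 1 ≤ t) where

  LeftFinishes : Config → Set
  LeftFinishes Y = ∃[ m ] run (leftGreedyStep t) m Y ≡ just (finished t)

  left-finishes-after : ∀ {Y Y'} → leftGreedyStep t Y ≡ just Y' → LeftFinishes Y' → LeftFinishes Y
  left-finishes-after eL (m , run≡) = suc m , trans (cong (_>>= run (leftGreedyStep t) m) eL) run≡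

  Simulation : ℕ → Set
  Simulation k = ∀ {X Y} → WellFormed t X → WellFormed t Y → Ahead Y X →
                 run (rightGreedyStep t) k X ≡ just (finished t) → LeftFinishes Y

  simulation-step : ∀ {k} → Simulation k → ∀ {X Y} → Acc _<_ (weight Y) → WellFormed t X → WellFormed t Y →
                    Ahead Y X → run (rightGreedyStep t) (suc k) X ≡ just (finished t) → LeftFinishes Y
  simulation-step {k} simulation {X} {Y} (acc rs) wfX wfY Y≽X runX with leftView wfY
  ... | advance eL step =
    left-finishes-after eL
      (simulation-step {k} simulation (rs (step-weight< wfY step)) wfX (step-wf wfY step) (advance-keeps-ahead wfY step Y≽X) runX)
  ... | push-only pushOnly pushL with rightGreedyStep t X in eR
  ...   | just X' with rightGreedyStep-just eR
  ...     | suc zero , push , _ =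
    let Y' , pushY , Y'≽X' = push-keeps-ahead 1≤t wfX wfY Y≽X (step-complete wfX push) in
    left-finishes-after (pushL (step-sound wfY pushY)) (simulation (move-wf wfX push) (step-wf wfY pushY) Y'≽X' runX)
  ...     | suc (suc s) , mv , blockedX =
    simulation (move-wf wfX mv) wfY
      (right-move-keeps-ahead wfX wfY Y≽X pushOnly (blockedX ∘ ≤-trans (s≤s z≤n)) (step-complete wfX mv)) runX

  simulation : ∀ k → Simulation k
  simulation zero    _ wfY Y≽X refl = 0 , cong just (ahead-finished wfY Y≽X)
  simulation (suc k) {Y = Y}        = simulation-step {k} (simulation k) (<-wellFounded (weight Y))

initial-wf : ∀ t {n p} → p ↭ map suc (upTo n) → WellFormed t (initial t p)
initial-wf t {n} {p} p↭ = record
  { length≡  = cong suc (length-replicate t)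
  ; ordered  = ordered′
  ; disjoint = disjoint′
  }
  where
    ordered′ : ∀ i → Ordered i (nth i (initial t p))
    ordered′ zero    = Unique-resp-↭ (↭⇒↭ₛ (↭-sym p↭)) (map⁺ suc-injective (upTo⁺ n))
    ordered′ (suc i) = subst Increasing (sym (nth-replicate i t)) refl
    disjoint′ : ∀ {i j v} → v ∈ nth i (initial t p) → v ∈ nth j (initial t p) → i ≡ j
    disjoint′ {zero}  {zero}  _  _  = refl
    disjoint′ {suc i}         v∈ _  with () ← subst (_ ∈_) (nth-replicate i t) v∈
    disjoint′ {zero}  {suc j} _  v∈ with () ← subst (_ ∈_) (nth-replicate j t) v∈

mainTheorem2 : (t : ℕ) → 1 ≤ t → (n : ℕ) → (p : List ℕ) → p ↭ map suc (upTo n)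
                 → Sorts t (rightGreedyStep t) p → Sorts t (leftGreedyStep t) p
mainTheorem2 t 1≤t n p p↭ (k , rightSorts) =
  simulation 1≤t k (initial-wf t p↭) (initial-wf t p↭) (ahead-refl (initial t p)) rightSorts
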